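{- Let $G$ be a connected graph, let $X\subseteq V(G)$, and let $H$ be a convex subgraph of $G$. If $X$ is a dual mutual-visibility set of $G$, then $X\cap V(H)$ is a dual mutual-visibility set of $H$. Likewise, if $X$ is an outer mutual-visibility set of $G$, then $X\cap V(H)$ is an outer mutual-visibility set of $H$; and if $X$ is a total mutual-visibility set of $G$, then $X\cap V(H)$ is a total mutual-visibility set of $H$.
   Context: All graphs are finite and simple. For a graph $G$ and $X\subseteq V(G)$, two vertices $x,y$ of $G$ are $X$-visible if there exists a shortest $x,y$-path in $G$ none of whose internal vertices belongs to $X$. Write $\overline{X}=V(G)\setminus X$. $X$ is a total mutual-visibility set if any two vertices of $V(G)$ are $X$-visible; a dual mutual-visibility set if any two vertices of $X$ are $X$-visible and any two vertices of $\overline{X}$ are $X$-visible; an outer mutual-visibility set if any two vertices of $X$ are $X$-visible and any $x\in X$, $y\in\overline{X}$ are $X$-visible. (Visibility in $H$ is meant with respect to shortest paths in $H$.) A subgraph $H$ of $G$ is convex if for any two vertices $u,v$ of $H$, every shortest $u,v$-path of $G$ lies in $H$. -}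

module Defs where

open import Data.Nat using (ℕ; zero; suc; _≤_)
open import Data.Fin using (Fin)
open import Data.Bool using (Bool; true; false; T)
open import Data.Unit using (⊤)
open import Data.Product using (Σ; _×_)
open import Relation.Nullary using (¬_)
open import Relation.Binary.PropositionalEquality using (_≡_)
open import Level using (0ℓ)
open import Relation.Unary using (Pred; _∈_; _∉_; _∩_; U)

record Graph (n : ℕ) : Set where
  field
    adj   : Fin n → Fin n → Bool
    sym   : ∀ x y → adj x y ≡ adj y x
    irrefl : ∀ x → adj x x ≡ false
open Graph public

record Subgraph {n : ℕ} (G : Graph n) : Set₁ where
  field
    vert  : Pred (Fin n) 0ℓ
    edge  : Fin n → Fin n → Bool
    edge-sym  : ∀ x y → edge x y ≡ edge y x
    edge-adj  : ∀ x y → T (edge x y) → T (adj G x y)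
    edge-vert : ∀ x y → T (edge x y) → (x ∈ vert) × (y ∈ vert)
open Subgraph public

data Walk {n : ℕ} (E : Fin n → Fin n → Bool) : Fin n → Fin n → Set where
  []  : ∀ {x} → Walk E x x
  _∷_ : ∀ {x y z} → T (E x y) → Walk E y z → Walk E x z

length : ∀ {n} {E : Fin n → Fin n → Bool} {x y} → Walk E x y → ℕ
length []      = zero
length (_ ∷ w) = suc (length w)

-- A shortest x,y-walk (= shortest x,y-path) w.r.t. E.
IsShortest : ∀ {n} {E : Fin n → Fin n → Bool} {x y} → Walk E x y → Set
IsShortest {E = E} {x} {y} w = ∀ (w' : Walk E x y) → length w ≤ length w'

InternalAvoid : ∀ {n} {E : Fin n → Fin n → Bool} {x y} →
                Pred (Fin n) 0ℓ → Walk E x y → Set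
InternalAvoid X []                 = ⊤
InternalAvoid X (_ ∷ [])           = ⊤
InternalAvoid X (_∷_ {y = y} _ w@(_ ∷ _)) = (y ∉ X) × InternalAvoid X w

WalkIn : ∀ {n} {E : Fin n → Fin n → Bool} {x y} →
         Pred (Fin n) 0ℓ → (Fin n → Fin n → Bool) → Walk E x y → Set
WalkIn {x = x} V E' []                  = x ∈ V
WalkIn {x = x} V E' (_∷_ {y = y} _ w)   = (x ∈ V) × T (E' x y) × WalkIn V E' w

Visible : ∀ {n} → (Fin n → Fin n → Bool) → Pred (Fin n) 0ℓ → Fin n → Fin n → Set
Visible E X x y = Σ (Walk E x y) λ w → IsShortest w × InternalAvoid X w

IsTotalMV : ∀ {n} → Pred (Fin n) 0ℓ → (Fin n → Fin n → Bool) → Pred (Fin n) 0ℓ → Set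
IsTotalMV V E X = ∀ x y → x ∈ V → y ∈ V → Visible E X x y

IsDualMV : ∀ {n} → Pred (Fin n) 0ℓ → (Fin n → Fin n → Bool) → Pred (Fin n) 0ℓ → Set
IsDualMV V E X =
  (∀ x y → x ∈ X → y ∈ X → Visible E X x y) ×
  (∀ x y → x ∈ V → x ∉ X → y ∈ V → y ∉ X → Visible E X x y)

IsOuterMV : ∀ {n} → Pred (Fin n) 0ℓ → (Fin n → Fin n → Bool) → Pred (Fin n) 0ℓ → Set
IsOuterMV V E X =
  (∀ x y → x ∈ X → y ∈ X → Visible E X x y) ×
  (∀ x y → x ∈ X → y ∈ V → y ∉ X → Visible E X x y)

Connected : ∀ {n} → Graph n → Set
Connected G = ∀ x y → Walk (adj G) x y

IsConvex : ∀ {n} {G : Graph n} → Subgraph G → Set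
IsConvex {G = G} H = ∀ u v → u ∈ vert H → v ∈ vert H →
  (w : Walk (adj G) u v) → IsShortest w → WalkIn (vert H) (edge H) w

module Submission where

open import Defs
open import Data.Nat using (ℕ; suc; _≤_)
open import Data.Nat.Properties using (≤-reflexive; module ≤-Reasoning)
open import Data.Fin using (Fin)
open import Data.Bool using (Bool; T)
open import Data.Product using (_×_; _,_; proj₁)
open import Data.Unit using (tt)
open import Level using (0ℓ)
open import Relation.Unary using (Pred; _∩_; U; _∈_; _∉_)
open import Relation.Binary.PropositionalEquality using (_≡_; refl; cong)

-- A shortest u,v-path of G lying in the convex subgraph H is a u,v-path of H;
-- it is shortest in H because every H-path is also a G-path of the same length,
-- and its internal vertices avoid X ∩ V(H) because they avoid X.

module _ {n : ℕ} where

  Edges : Set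
  Edges = Fin n → Fin n → Bool

  _⊆ᴱ_ : Edges → Edges → Set
  E' ⊆ᴱ E = ∀ x y → T (E' x y) → T (E x y)

  mapWalk : ∀ {E' E} → E' ⊆ᴱ E → ∀ {x y} → Walk E' x y → Walk E x y
  mapWalk E'⊆E []                  = []
  mapWalk E'⊆E (_∷_ {x} {y} e w) = E'⊆E x y e ∷ mapWalk E'⊆E w

  length-mapWalk : ∀ {E' E} (E'⊆E : E' ⊆ᴱ E) {x y} (w : Walk E' x y) →
                   length (mapWalk E'⊆E w) ≡ length w
  length-mapWalk E'⊆E []      = refl
  length-mapWalk E'⊆E (_ ∷ w) = cong suc (length-mapWalk E'⊆E w)

  shortest-⊆ᴱ : ∀ {E' E} → E' ⊆ᴱ E → ∀ {x y} (w' : Walk E' x y) (w : Walk E x y) →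
                length w' ≤ length w → IsShortest w → IsShortest w'
  shortest-⊆ᴱ E'⊆E w' w w'≤w w-shortest v' = begin
    length w'                 ≤⟨ w'≤w ⟩
    length w                  ≤⟨ w-shortest (mapWalk E'⊆E v') ⟩
    length (mapWalk E'⊆E v')  ≡⟨ length-mapWalk E'⊆E v' ⟩
    length v'                 ∎
    where open ≤-Reasoning

module _ {n : ℕ} {E E' : Edges {n}} {V : Pred (Fin n) 0ℓ} where

  restrictWalk : ∀ {x y} (w : Walk E x y) → WalkIn V E' w → Walk E' x y
  restrictWalk []      _              = []
  restrictWalk (_ ∷ w) (_ , e' , w∈) = e' ∷ restrictWalk w w∈

  length-restrictWalk : ∀ {x y} (w : Walk E x y) (w∈ : WalkIn V E' w) →
                        length (restrictWalk w w∈) ≡ length w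
  length-restrictWalk []      _            = refl
  length-restrictWalk (_ ∷ w) (_ , _ , w∈) = cong suc (length-restrictWalk w w∈)

  restrictWalk-avoid : ∀ {X : Pred (Fin n) 0ℓ} {x y} (w : Walk E x y) (w∈ : WalkIn V E' w) →
                       InternalAvoid X w → InternalAvoid (X ∩ V) (restrictWalk w w∈)
  restrictWalk-avoid []                _            _            = tt
  restrictWalk-avoid (_ ∷ [])          _            _            = tt
  restrictWalk-avoid (_ ∷ w@(_ ∷ _)) (_ , _ , w∈) (y∉X , avoid) =
    (λ y∈X∩V → y∉X (proj₁ y∈X∩V)) , restrictWalk-avoid w w∈ avoid

module _ {n} {G : Graph n} (X : Pred (Fin n) 0ℓ) (H : Subgraph G) (convex : IsConvex H) where

  convex-visible : ∀ {x y} → x ∈ vert H → y ∈ vert H →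
                   Visible (adj G) X x y → Visible (edge H) (X ∩ vert H) x y
  convex-visible {x} {y} x∈H y∈H (w , w-shortest , w-avoid) =
    wᴴ , shortest-⊆ᴱ (edge-adj H) wᴴ w (≤-reflexive (length-restrictWalk w w∈H)) w-shortest
       , restrictWalk-avoid w w∈H w-avoid
    where
      w∈H : WalkIn (vert H) (edge H) w
      w∈H = convex x y x∈H y∈H w w-shortest

      wᴴ : Walk (edge H) x y
      wᴴ = restrictWalk w w∈H

  private
    ∉∩⇒∉ : ∀ {x} → x ∈ vert H → x ∉ X ∩ vert H → x ∉ X
    ∉∩⇒∉ x∈H x∉X∩H x∈X = x∉X∩H (x∈X , x∈H)

    visible-inside : (∀ x y → x ∈ X → y ∈ X → Visible (adj G) X x y) →
                     ∀ x y → x ∈ X ∩ vert H → y ∈ X ∩ vert H → Visible (edge H) (X ∩ vert H) x y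
    visible-inside inX x y (x∈X , x∈H) (y∈X , y∈H) = convex-visible x∈H y∈H (inX x y x∈X y∈X)

  dualMV-convex : IsDualMV U (adj G) X → IsDualMV (vert H) (edge H) (X ∩ vert H)
  dualMV-convex (inX , outX) =
    visible-inside inX ,
    λ x y x∈H x∉ y∈H y∉ → convex-visible x∈H y∈H (outX x y tt (∉∩⇒∉ x∈H x∉) tt (∉∩⇒∉ y∈H y∉))

  outerMV-convex : IsOuterMV U (adj G) X → IsOuterMV (vert H) (edge H) (X ∩ vert H)
  outerMV-convex (inX , mixed) =
    visible-inside inX ,
    λ x y (x∈X , x∈H) y∈H y∉ → convex-visible x∈H y∈H (mixed x y x∈X tt (∉∩⇒∉ y∈H y∉))

  totalMV-convex : IsTotalMV U (adj G) X → IsTotalMV (vert H) (edge H) (X ∩ vert H)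
  totalMV-convex all x y x∈H y∈H = convex-visible x∈H y∈H (all x y tt tt)

lemma2p4 : ∀ {n} (G : Graph n) (X : Pred (Fin n) 0ℓ) (H : Subgraph G) →
    Connected G → IsConvex H →
    ((IsDualMV U (adj G) X → IsDualMV (vert H) (edge H) (X ∩ vert H)) ×
     (IsOuterMV U (adj G) X → IsOuterMV (vert H) (edge H) (X ∩ vert H)) ×
     (IsTotalMV U (adj G) X → IsTotalMV (vert H) (edge H) (X ∩ vert H)))
lemma2p4 G X H _ convex =
  dualMV-convex X H convex , outerMV-convex X H convex , totalMV-convex X H convex
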